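{- Let $G=(V,E)$ be a weighted multi-graph with integer edge weights in $\{1,\dots,W\}$ and capacities $\{b_v\}_{v\in V}$, let $\beta\geq 3$, $\beta^-\leq\beta-2$ be integers, and let $H$ be a $(\beta,\beta^-)$-$w$-$b$-EDCS of $G$. Then, for all $v \in V$, $\deg_H(v) \leq \beta \cdot b_v$.
   Context: A weighted multi-graph $G=(V,E)$ has a multi-set of weighted edges $(u,v,k)$ with $u\neq v$ and weight $k\in\{1,\dots,W\}$. Each vertex $v$ has a positive integer capacity $b_v$, and the number of edges between any two vertices $u,v$ is at most $\min(b_u,b_v)$. For a subgraph $H$, $\delta_H(v)$ is the multi-set of edges of $H$ incident to $v$, $\deg_H(v)=|\delta_H(v)|$, and $\mathbf{w}\!\deg_H(v)=\sum_{e\in\delta_H(v)}w(e)$. A subgraph $H$ is a $(\beta,\beta^-)$-$w$-$b$-EDCS of $G$ if (i) for every edge $(u,v,w_{uv})\in H$, $\frac{\mathbf{w}\!\deg_H(u)}{b_u}+\frac{\mathbf{w}\!\deg_H(v)}{b_v}\leq\beta\cdot w_{uv}$, and (ii) for every edge $(u,v,w_{uv})\in G\setminus H$, $\frac{\mathbf{w}\!\deg_H(u)}{b_u}+\frac{\mathbf{w}\!\deg_H(v)}{b_v}\geq\beta^-\cdot w_{uv}$. -}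

module Defs where

open import Data.Nat using (ℕ; zero; suc; _+_; _*_; _≤_; _<_; _⊓_; NonZero; >-nonZero)
open import Data.Fin using (Fin; zero; suc)
open import Data.Bool using (Bool; true; false; if_then_else_)
open import Data.Product using (_×_; _,_)
open import Data.Integer using (ℤ; +_)
open import Data.Rational using (ℚ; _/_) renaming (_+_ to _+ℚ_; _*_ to _*ℚ_; _≤_ to _≤ℚ_)
open import Relation.Binary.PropositionalEquality using (_≡_; _≢_)
open import Relation.Nullary using (¬_)
open import Relation.Nullary.Decidable using (⌊_⌋)
open import Data.Fin using (_≟_)

sumFin : (m : ℕ) → (Fin m → ℕ) → ℕ
sumFin zero    f = 0
sumFin (suc m) f = f zero + sumFin m (λ i → f (suc i))

-- A weighted multi-graph on vertex set Fin n with m edges (the multi-set of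
-- edges is given as an indexed family; parallel edges are distinct indices).
record WMultiGraph (n m : ℕ) : Set where
  field
    src tgt : Fin m → Fin n
    wt      : Fin m → ℕ
open WMultiGraph public

joins : ∀ {n m} → WMultiGraph n m → Fin m → Fin n → Fin n → Bool
joins G e u v =
  (⌊ src G e ≟ u ⌋ Data.Bool.∧ ⌊ tgt G e ≟ v ⌋) Data.Bool.∨
  (⌊ src G e ≟ v ⌋ Data.Bool.∧ ⌊ tgt G e ≟ u ⌋)

incident : ∀ {n m} → WMultiGraph n m → Fin m → Fin n → Bool
incident G e v = ⌊ src G e ≟ v ⌋ Data.Bool.∨ ⌊ tgt G e ≟ v ⌋

multiplicity : ∀ {n m} → WMultiGraph n m → Fin n → Fin n → ℕ
multiplicity {m = m} G u v = sumFin m (λ e → if joins G e u v then 1 else 0)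

record IsWeightedMultiGraph {n m} (G : WMultiGraph n m) (W : ℕ) (b : Fin n → ℕ) : Set where
  field
    noLoop    : ∀ e → src G e ≢ tgt G e
    wt-pos    : ∀ e → 1 ≤ wt G e
    wt-le-W   : ∀ e → wt G e ≤ W
    cap-pos   : ∀ v → 1 ≤ b v
    mult-le   : ∀ u v → u ≢ v → multiplicity G u v ≤ (b u ⊓ b v)

Subgraph : ∀ {n m} → WMultiGraph n m → Set
Subgraph {m = m} G = Fin m → Bool

deg : ∀ {n m} (G : WMultiGraph n m) → Subgraph G → Fin n → ℕ
deg {m = m} G H v = sumFin m (λ e → if H e Data.Bool.∧ incident G e v then 1 else 0)

wdeg : ∀ {n m} (G : WMultiGraph n m) → Subgraph G → Fin n → ℕ
wdeg {m = m} G H v = sumFin m (λ e → if H e Data.Bool.∧ incident G e v then wt G e else 0)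

normDeg : ∀ {n m} (G : WMultiGraph n m) → Subgraph G → (b : Fin n → ℕ) →
          (∀ v → 1 ≤ b v) → Fin n → ℚ
normDeg G H b pos v = _/_ (+ wdeg G H v) (b v) {{ >-nonZero (pos v) }}

record IsEDCS {n m} (G : WMultiGraph n m) (b : Fin n → ℕ) (pos : ∀ v → 1 ≤ b v)
              (β β⁻ : ℤ) (H : Subgraph G) : Set where
  field
    edcs-in  : ∀ e → H e ≡ true →
      (normDeg G H b pos (src G e) +ℚ normDeg G H b pos (tgt G e))
        ≤ℚ (β / 1) *ℚ ((+ wt G e) / 1)
    edcs-out : ∀ e → H e ≡ false →
      (β⁻ / 1) *ℚ ((+ wt G e) / 1)
        ≤ℚ (normDeg G H b pos (src G e) +ℚ normDeg G H b pos (tgt G e))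

{-# OPTIONS --safe #-}
-- For an edge e of H at v the EDCS constraint gives wdeg_H(v) ≤ β b_v w(e).
-- Averaging these bounds with weights w(e) over the edges of H at v yields
-- wdeg_H(v) deg_H(v) ≤ β b_v wdeg_H(v), so deg_H(v) ≤ β b_v unless
-- wdeg_H(v) = 0, in which case deg_H(v) = 0 too because all weights are positive.
module Submission where

open import Defs
open import Data.Nat using (ℕ; _≤_; _*_)
open import Data.Fin using (Fin; zero; suc; _≟_)
open import Data.Integer using (ℤ; +_; _-_) renaming (_≤_ to _≤ℤ_)

open import Data.Nat using (zero; suc; pred; _+_; NonZero; z≤n; >-nonZero)
import Data.Nat.Properties as ℕ
open import Data.Bool using (Bool; true; false; _∧_; if_then_else_)
open import Data.Sum using (_⊎_; inj₁; inj₂)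
import Data.Integer as ℤ
import Data.Integer.Properties as ℤ
open import Data.Rational as ℚ using (ℚ; _/_; toℚᵘ) renaming (_≤_ to _≤ℚ_)
import Data.Rational.Properties as ℚ
open import Data.Rational.Unnormalised as ℚᵘ using (mkℚᵘ; *≡*; *≤*)
import Data.Rational.Unnormalised.Properties as ℚᵘ
open import Relation.Binary.PropositionalEquality
open import Relation.Nullary using (yes; no)
open import Algebra.Properties.CommutativeSemigroup ℕ.*-commutativeSemigroup using (xy∙z≈xz∙y)

sumFin-mono-≤ : ∀ m {f g : Fin m → ℕ} → (∀ i → f i ≤ g i) → sumFin m f ≤ sumFin m g
sumFin-mono-≤ zero    f≤g = z≤n
sumFin-mono-≤ (suc m) f≤g = ℕ.+-mono-≤ (f≤g zero) (sumFin-mono-≤ m (λ i → f≤g (suc i)))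

sumFin-*ˡ : ∀ m k (f : Fin m → ℕ) → sumFin m (λ i → k * f i) ≡ k * sumFin m f
sumFin-*ˡ zero    k f = sym (ℕ.*-zeroʳ k)
sumFin-*ˡ (suc m) k f = begin
  k * f zero + sumFin m (λ i → k * f (suc i)) ≡⟨ cong (_+_ (k * f zero)) (sumFin-*ˡ m k (λ i → f (suc i))) ⟩
  k * f zero + k * sumFin m (λ i → f (suc i)) ≡⟨ ℕ.*-distribˡ-+ k (f zero) _ ⟨
  k * sumFin (suc m) f                        ∎
  where open ≡-Reasoning

sumFin-≤-by-average : ∀ m (c w : Fin m → ℕ) K → (∀ i → c i ≤ w i) →
  (∀ i → sumFin m w * c i ≤ K * w i) → sumFin m c ≤ K
sumFin-≤-by-average m c w K c≤w bound with sumFin m w in S≡ | sumFin-mono-≤ m c≤w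
... | zero  | Σc≤0 = ℕ.≤-trans Σc≤0 z≤n
... | suc s | _    = ℕ.*-cancelˡ-≤ (suc s) (begin
  suc s * sumFin m c           ≡⟨ sumFin-*ˡ m (suc s) c ⟨
  sumFin m (λ i → suc s * c i) ≤⟨ sumFin-mono-≤ m bound ⟩
  sumFin m (λ i → K * w i)     ≡⟨ sumFin-*ˡ m K w ⟩
  K * sumFin m w               ≡⟨ cong (K *_) S≡ ⟩
  K * suc s                    ≡⟨ ℕ.*-comm K (suc s) ⟩
  suc s * K                    ∎)
  where open ℕ.≤-Reasoning

indicator≤weight : ∀ (c : Bool) {w} → 1 ≤ w → (if c then 1 else 0) ≤ (if c then w else 0)
indicator≤weight true  1≤w = 1≤w
indicator≤weight false _   = z≤n

p≤p+q : ∀ p q .{{_ : ℚ.NonNegative q}} → p ≤ℚ p ℚ.+ q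
p≤p+q p q = ℚ.toℚᵘ-cancel-≤
  (ℚᵘ.≤-respʳ-≃ (ℚᵘ.≃-sym (ℚ.toℚᵘ-homo-+ p q)) (ℚᵘ.p≤p+q (toℚᵘ p) (toℚᵘ q)))

q≤p+q : ∀ p q .{{_ : ℚ.NonNegative p}} → q ≤ℚ p ℚ.+ q
q≤p+q p q = subst (q ≤ℚ_) (ℚ.+-comm q p) (p≤p+q q p)

toℚᵘ-/ : ∀ a d .{{_ : NonZero d}} → toℚᵘ (+ a / d) ℚᵘ.≃ mkℚᵘ (+ a) (pred d)
toℚᵘ-/ a (suc d) = ℚ.toℚᵘ-fromℚᵘ (mkℚᵘ (+ a) d)

[m/1]*[n/1]≡[m*n]/1 : ∀ m n → (+ m / 1) ℚ.* (+ n / 1) ≡ + (m * n) / 1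
[m/1]*[n/1]≡[m*n]/1 m n = ℚ.toℚᵘ-injective (begin-equality
  toℚᵘ ((+ m / 1) ℚ.* (+ n / 1))           ≃⟨ ℚ.toℚᵘ-homo-* (+ m / 1) (+ n / 1) ⟩
  toℚᵘ (+ m / 1) ℚᵘ.* toℚᵘ (+ n / 1)       ≃⟨ ℚᵘ.*-cong (toℚᵘ-/ m 1) (toℚᵘ-/ n 1) ⟩
  mkℚᵘ (+ m) 0 ℚᵘ.* mkℚᵘ (+ n) 0           ≃⟨ *≡* (cong (ℤ._* + 1) (sym (ℤ.pos-* m n))) ⟩
  mkℚᵘ (+ (m * n)) 0                       ≃⟨ ℚᵘ.≃-sym (toℚᵘ-/ (m * n) 1) ⟩
  toℚᵘ (+ (m * n) / 1)                     ∎)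
  where open ℚᵘ.≤-Reasoning

a/d≤k⇒a≤k*d : ∀ a k d .{{_ : NonZero d}} → + a / d ≤ℚ + k / 1 → a ≤ k * d
a/d≤k⇒a≤k*d a k d@(suc _) a/d≤k
  with *≤* a≤kd ← ℚᵘ.≤-respʳ-≃ (toℚᵘ-/ k 1) (ℚᵘ.≤-respˡ-≃ (toℚᵘ-/ a d) (ℚ.toℚᵘ-mono-≤ a/d≤k))
  = ℤ.drop‿+≤+ (subst₂ _≤ℤ_ (ℤ.*-identityʳ (+ a)) (sym (ℤ.pos-* k d)) a≤kd)

incident⇒endpoint : ∀ {n m} (G : WMultiGraph n m) e v →
  incident G e v ≡ true → src G e ≡ v ⊎ tgt G e ≡ v
incident⇒endpoint G e v _ with src G e ≟ v | tgt G e ≟ v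
... | yes s≡v | _       = inj₁ s≡v
... | no _    | yes t≡v = inj₂ t≡v

module _ {n m W : ℕ} {G : WMultiGraph n m} {b : Fin n → ℕ}
         (wf : IsWeightedMultiGraph G W b) {β : ℕ} {β⁻ : ℤ} {H : Subgraph G}
         (edcs : IsEDCS G b (IsWeightedMultiGraph.cap-pos wf) (+ β) β⁻ H) where

  open IsWeightedMultiGraph wf

  ν : Fin n → ℚ
  ν = normDeg G H b cap-pos

  normDeg-nonNeg : ∀ v → ℚ.NonNegative (ν v)
  normDeg-nonNeg v = ℚ.normalize-nonNeg (wdeg G H v) (b v) {{>-nonZero (cap-pos v)}}

  edcs-in-≤ : ∀ e → H e ≡ true →
    ν (src G e) ℚ.+ ν (tgt G e) ≤ℚ + (β * wt G e) / 1
  edcs-in-≤ e e∈H = subst (_ ≤ℚ_) ([m/1]*[n/1]≡[m*n]/1 β (wt G e)) (IsEDCS.edcs-in edcs e e∈H)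

  normDeg-endpoint≤ : ∀ e v → H e ≡ true → incident G e v ≡ true →
    ν v ≤ℚ + (β * wt G e) / 1
  normDeg-endpoint≤ e v e∈H e∋v with incident⇒endpoint G e v e∋v
  ... | inj₁ refl = ℚ.≤-trans (p≤p+q (ν v) (ν (tgt G e)) {{normDeg-nonNeg (tgt G e)}}) (edcs-in-≤ e e∈H)
  ... | inj₂ refl = ℚ.≤-trans (q≤p+q (ν (src G e)) (ν v) {{normDeg-nonNeg (src G e)}}) (edcs-in-≤ e e∈H)

  wdeg-endpoint≤ : ∀ e v → H e ≡ true → incident G e v ≡ true →
    wdeg G H v ≤ β * b v * wt G e
  wdeg-endpoint≤ e v e∈H e∋v = subst (wdeg G H v ≤_) (xy∙z≈xz∙y β (wt G e) (b v))
    (a/d≤k⇒a≤k*d (wdeg G H v) (β * wt G e) (b v) {{>-nonZero (cap-pos v)}}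
      (normDeg-endpoint≤ e v e∈H e∋v))

  wdeg*indicator≤ : ∀ v e →
    wdeg G H v * (if H e ∧ incident G e v then 1 else 0)
      ≤ β * b v * (if H e ∧ incident G e v then wt G e else 0)
  wdeg*indicator≤ v e with H e in e∈H | incident G e v in e∋v
  ... | true  | true  = subst (_≤ β * b v * wt G e) (sym (ℕ.*-identityʳ (wdeg G H v)))
                          (wdeg-endpoint≤ e v e∈H e∋v)
  ... | true  | false = ℕ.≤-reflexive (trans (ℕ.*-zeroʳ (wdeg G H v)) (sym (ℕ.*-zeroʳ (β * b v))))
  ... | false | _     = ℕ.≤-reflexive (trans (ℕ.*-zeroʳ (wdeg G H v)) (sym (ℕ.*-zeroʳ (β * b v))))

proposition17 : (n m W : ℕ) (G : WMultiGraph n m) (b : Fin n → ℕ)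
    → (wf : IsWeightedMultiGraph G W b)
    → (β : ℕ) (β⁻ : ℤ) → 3 ≤ β → β⁻ ≤ℤ (+ β) - (+ 2)
    → (H : Subgraph G)
    → IsEDCS G b (IsWeightedMultiGraph.cap-pos wf) (+ β) β⁻ H
    → ∀ v → deg G H v ≤ β * b v
proposition17 n m W G b wf β β⁻ _ _ H edcs v =
  sumFin-≤-by-average m
    (λ e → if H e ∧ incident G e v then 1 else 0)
    (λ e → if H e ∧ incident G e v then wt G e else 0)
    (β * b v)
    (λ e → indicator≤weight (H e ∧ incident G e v) (IsWeightedMultiGraph.wt-pos wf e))
    (wdeg*indicator≤ wf edcs v)
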